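{- Let $C_3\in\mathbb{N}_{\ge1}$ and $D\in\mathbb{Z}\setminus\{0\}$ with $\gcd(C_3,D)=1$, and fix $(u,v)\in\mathbb{Z}^2$ with $\gcd(u,v)=1$ and $\min(u^2,v^2)>-D/C_3$. Set $k(u,v)=\gcd(C_3u^2+D,\,C_3v^2+D)$. Then, for $(a,b)\in\mathbb{N}^2$ with $\gcd(a,b)=1$, one has [$C_3\mid b-a$ and $au^2-bv^2=\frac{b-a}{C_3}D$] if and only if $(a,b)=\left(\dfrac{C_3v^2+D}{k(u,v)},\dfrac{C_3u^2+D}{k(u,v)}\right)$. In particular such a pair $(a,b)$ exists and is unique. -}

module Defs where

open import Data.Nat.Base as ℕ using (ℕ; zero; suc)
open import Data.Integer.Base using (ℤ; +_; -[1+_]; 0ℤ; _+_; _-_; _*_; _/_; _/ℕ_; _^_)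
open import Data.Integer.Divisibility using (_∣_)
open import Data.Integer.GCD using (gcd)
open import Data.Product.Base using (_×_)
open import Relation.Binary.PropositionalEquality using (_≡_)

-- Integer division, total by the convention x ÷ 0 = 0.  It is only ever
-- applied to k(u,v), which is nonzero under the theorem's hypotheses.
_÷_ : ℤ → ℤ → ℤ
x ÷ (+ zero)   = 0ℤ
x ÷ (+ suc n)  = x / (+ suc n)
x ÷ (-[1+ n ]) = x / (-[1+ n ])

kuv : ℕ → ℤ → ℤ → ℤ → ℤ
kuv C₃ D u v = gcd (+ C₃ * u ^ 2 + D) (+ C₃ * v ^ 2 + D)

Cond : (C₃ : ℕ) .{{_ : ℕ.NonZero C₃}} → ℤ → ℤ → ℤ → ℕ → ℕ → Set
Cond C₃ D u v a b =
  ((+ C₃) ∣ (+ b - + a)) ×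
  (+ a * u ^ 2 - + b * v ^ 2 ≡ ((+ b - + a) /ℕ C₃) * D)

{-# OPTIONS --safe #-}
module Submission where

-- Put X = C u² + D and Y = C v² + D; the bound on min(u², v²) makes both positive.
-- Since a X − b Y = C (a u² − b v²) − (b − a) D, the condition says exactly that
-- C ∣ b − a and a X = b Y.  For coprime a, b the equation a X = b Y forces
-- (a, b) = (Y, X) / gcd(X, Y).  Conversely, for this pair g = gcd(X, Y) satisfies
-- g (b − a) = X − Y = C (u² − v²), and C is prime to g because a common divisor of
-- C and X divides D; hence C ∣ b − a.

open import Defs
open import Data.Nat.Base as ℕ using (ℕ; suc)
import Data.Nat.Properties as ℕP
import Data.Nat.GCD as ℕG
import Data.Nat.Divisibility as ℕD
import Data.Nat.DivMod as ℕM
open import Data.Nat.Coprimality as ℕC using (Coprime)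
open import Data.Integer.Base using (ℤ; +_; -[1+_]; -_; 0ℤ; 1ℤ; _+_; _-_; _*_; _<_; _⊓_; _^_; ∣_∣; _/ℕ_; _%ℕ_; >-nonZero)
import Data.Integer.Properties as ℤP
open import Data.Integer.Divisibility using (_∣_)
import Data.Integer.Divisibility.Signed as ℤS
open import Data.Integer.DivMod using (a≡a%ℕn+[a/ℕn]*n; div-pos-is-/ℕ)
open import Data.Integer.GCD using (gcd)
open import Data.Integer.Tactic.RingSolver using (solve-∀)
open import Data.Product.Base using (_×_; _,_; ∃-syntax; proj₂)
open import Data.Product.Properties using (,-injective)
open import Function.Bundles using (_⇔_; mk⇔; Equivalence)
open import Function.Properties.Equivalence using () renaming (trans to ⇔-trans)
open import Relation.Binary.PropositionalEquality
import Algebra.Properties.CommutativeSemigroup as CommSemigroupProperties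

∣⇒%ℕ≡0 : ∀ i d .{{_ : ℕ.NonZero d}} → + d ∣ i → i %ℕ d ≡ 0
∣⇒%ℕ≡0 (+ n)    d d∣n = ℕD.n∣m⇒m%n≡0 n d d∣n
∣⇒%ℕ≡0 -[1+ n ] d d∣n rewrite ℕD.n∣m⇒m%n≡0 (suc n) d d∣n = refl

∣⇒[i/ℕd]*d≡i : ∀ i d .{{_ : ℕ.NonZero d}} → + d ∣ i → (i /ℕ d) * + d ≡ i
∣⇒[i/ℕd]*d≡i i d d∣i = sym (begin
  i                          ≡⟨ a≡a%ℕn+[a/ℕn]*n i d ⟩
  + (i %ℕ d) + i /ℕ d * + d  ≡⟨ cong (λ r → + r + i /ℕ d * + d) (∣⇒%ℕ≡0 i d d∣i) ⟩
  0ℤ + i /ℕ d * + d          ≡⟨ ℤP.+-identityˡ _ ⟩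
  i /ℕ d * + d               ∎)
  where open ≡-Reasoning

coprime-cross⇒≡ : ∀ {a b c d} → Coprime a b → Coprime c d → a ℕ.* d ≡ b ℕ.* c → a ≡ c × b ≡ d
coprime-cross⇒≡ {a} {b} {c} {d} a⊥b c⊥d ad≡bc =
  ℕD.∣-antisym a∣c c∣a , ℕD.∣-antisym b∣d d∣b
  where
  a∣c : a ℕD.∣ c
  a∣c = ℕC.coprime-divisor a⊥b (subst (a ℕD.∣_) ad≡bc (ℕD.m∣m*n d))
  b∣d : b ℕD.∣ d
  b∣d = ℕC.coprime-divisor (ℕC.sym a⊥b) (subst (b ℕD.∣_) (sym ad≡bc) (ℕD.m∣m*n c))
  c∣a : c ℕD.∣ a
  c∣a = ℕC.coprime-divisor c⊥d (subst (c ℕD.∣_) (trans (sym ad≡bc) (ℕP.*-comm a d)) (ℕD.n∣m*n b))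
  d∣b : d ℕD.∣ b
  d∣b = ℕC.coprime-divisor (ℕC.sym c⊥d) (subst (d ℕD.∣_) (trans ad≡bc (ℕP.*-comm b c)) (ℕD.n∣m*n a))

*-cross≡⇔≡/gcd : ∀ {a b} x y .{{_ : ℕ.NonZero (ℕG.gcd x y)}} → Coprime a b →
  a ℕ.* x ≡ b ℕ.* y ⇔ (a ≡ y ℕ./ ℕG.gcd x y × b ≡ x ℕ./ ℕG.gcd x y)
*-cross≡⇔≡/gcd {a} {b} x y a⊥b = mk⇔ to from
  where
  open ≡-Reasoning
  g x′ y′ : ℕ
  g  = ℕG.gcd x y
  x′ = x ℕ./ g
  y′ = y ℕ./ g
  x′g≡x : x′ ℕ.* g ≡ x
  x′g≡x = ℕM.m/n*n≡m (ℕG.gcd[m,n]∣m x y)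
  y′g≡y : y′ ℕ.* g ≡ y
  y′g≡y = ℕM.m/n*n≡m (ℕG.gcd[m,n]∣n x y)

  to : a ℕ.* x ≡ b ℕ.* y → a ≡ y′ × b ≡ x′
  to ax≡by = coprime-cross⇒≡ a⊥b (ℕC.sym (ℕC.coprime-/gcd x y)) (ℕP.*-cancelʳ-≡ _ _ g (begin
    a ℕ.* x′ ℕ.* g    ≡⟨ ℕP.*-assoc a x′ g ⟩
    a ℕ.* (x′ ℕ.* g)  ≡⟨ cong (a ℕ.*_) x′g≡x ⟩
    a ℕ.* x           ≡⟨ ax≡by ⟩
    b ℕ.* y           ≡⟨ cong (b ℕ.*_) y′g≡y ⟨
    b ℕ.* (y′ ℕ.* g)  ≡⟨ ℕP.*-assoc b y′ g ⟨
    b ℕ.* y′ ℕ.* g    ∎))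

  from : a ≡ y′ × b ≡ x′ → a ℕ.* x ≡ b ℕ.* y
  from (refl , refl) = begin
    y′ ℕ.* x            ≡⟨ cong (y′ ℕ.*_) x′g≡x ⟨
    y′ ℕ.* (x′ ℕ.* g)   ≡⟨ x∙yz≈y∙xz y′ x′ g ⟩
    x′ ℕ.* (y′ ℕ.* g)   ≡⟨ cong (x′ ℕ.*_) y′g≡y ⟩
    x′ ℕ.* y            ∎
    where open CommSemigroupProperties ℕP.*-commutativeSemigroup using (x∙yz≈y∙xz)

∣[c*u+d]⇒coprime : ∀ c n (u d : ℤ) → Coprime c ∣ d ∣ → n ℕD.∣ ∣ + c * u + d ∣ → Coprime c n
∣[c*u+d]⇒coprime c n u d c⊥d n∣cu+d {i} (i∣c , i∣n) = c⊥d (i∣c , ℤS.∣⇒∣ᵤ (ℤS.∣m+n∣m⇒∣n i∣cu+d i∣cu))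
  where
  i∣cu+d : + i ℤS.∣ + c * u + d
  i∣cu+d = ℤS.∣ᵤ⇒∣ (ℕD.∣-trans i∣n n∣cu+d)
  i∣cu : + i ℤS.∣ + c * u
  i∣cu = ℤS.∣m⇒∣m*n u (ℤS.∣ᵤ⇒∣ {+ i} {+ c} i∣c)

coprime-divisorᶻ : ∀ {c g} (i : ℤ) → Coprime c g → + c ∣ + g * i → + c ∣ i
coprime-divisorᶻ {c} {g} i c⊥g c∣gi = ℕC.coprime-divisor c⊥g (subst (c ℕD.∣_) (ℤP.abs-* (+ g) i) c∣gi)

cross-difference : ∀ (a b c U V d q : ℤ) → b - a ≡ q * c →
  a * (c * U + d) - b * (c * V + d) ≡ c * (a * U - b * V - q * d)
cross-difference a b c U V d q b-a≡qc = begin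
  a * (c * U + d) - b * (c * V + d)  ≡⟨ expand a b c U V d ⟩
  c * (a * U - b * V) - (b - a) * d  ≡⟨ cong (λ t → c * (a * U - b * V) - t * d) b-a≡qc ⟩
  c * (a * U - b * V) - q * c * d    ≡⟨ collect a b c U V d q ⟩
  c * (a * U - b * V - q * d)        ∎
  where
  open ≡-Reasoning
  expand : ∀ (a b c U V d : ℤ) → a * (c * U + d) - b * (c * V + d) ≡ c * (a * U - b * V) - (b - a) * d
  expand = solve-∀
  collect : ∀ (a b c U V d q : ℤ) → c * (a * U - b * V) - q * c * d ≡ c * (a * U - b * V - q * d)
  collect = solve-∀

Cond⇔∣×cross : ∀ C .{{_ : ℕ.NonZero C}} D u v a b →
  Cond C D u v a b ⇔ (+ C ∣ + b - + a × + a * (+ C * u ^ 2 + D) ≡ + b * (+ C * v ^ 2 + D))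
Cond⇔∣×cross C D u v a b = mk⇔ to from
  where
  q : ℤ
  q = (+ b - + a) /ℕ C
  difference : + C ∣ + b - + a →
    + a * (+ C * u ^ 2 + D) - + b * (+ C * v ^ 2 + D) ≡ + C * (+ a * u ^ 2 - + b * v ^ 2 - q * D)
  difference C∣b-a = cross-difference (+ a) (+ b) (+ C) (u ^ 2) (v ^ 2) D q
    (sym (∣⇒[i/ℕd]*d≡i (+ b - + a) C C∣b-a))
  to : Cond C D u v a b → + C ∣ + b - + a × + a * (+ C * u ^ 2 + D) ≡ + b * (+ C * v ^ 2 + D)
  to (C∣b-a , e) = C∣b-a , ℤP.i-j≡0⇒i≡j _ _ (begin
    + a * (+ C * u ^ 2 + D) - + b * (+ C * v ^ 2 + D)  ≡⟨ difference C∣b-a ⟩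
    + C * (+ a * u ^ 2 - + b * v ^ 2 - q * D)          ≡⟨ cong (+ C *_) (ℤP.i≡j⇒i-j≡0 e) ⟩
    + C * 0ℤ                                           ≡⟨ ℤP.*-zeroʳ (+ C) ⟩
    0ℤ                                                 ∎)
    where open ≡-Reasoning
  from : + C ∣ + b - + a × + a * (+ C * u ^ 2 + D) ≡ + b * (+ C * v ^ 2 + D) → Cond C D u v a b
  from (C∣b-a , e) = C∣b-a , ℤP.i-j≡0⇒i≡j _ _ (ℤP.*-cancelˡ-≡ (+ C) _ 0ℤ (begin
    + C * (+ a * u ^ 2 - + b * v ^ 2 - q * D)          ≡⟨ difference C∣b-a ⟨
    + a * (+ C * u ^ 2 + D) - + b * (+ C * v ^ 2 + D)  ≡⟨ ℤP.i≡j⇒i-j≡0 e ⟩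
    0ℤ                                                 ≡⟨ ℤP.*-zeroʳ (+ C) ⟨
    + C * 0ℤ                                           ∎))
    where open ≡-Reasoning

Cond⇔≡/gcd : ∀ C .{{_ : ℕ.NonZero C}} D u v x y .{{_ : ℕ.NonZero (ℕG.gcd x y)}} →
  Coprime C ∣ D ∣ → + C * u ^ 2 + D ≡ + x → + C * v ^ 2 + D ≡ + y →
  ∀ {a b} → Coprime a b → Cond C D u v a b ⇔ (a ≡ y ℕ./ ℕG.gcd x y × b ≡ x ℕ./ ℕG.gcd x y)
Cond⇔≡/gcd C D u v x y C⊥D X≡x Y≡y {a} {b} a⊥b = mk⇔
  (λ c → Equivalence.to (*-cross≡⇔≡/gcd x y a⊥b) (cross⇒crossᴺ (proj₂ (Equivalence.to Cond⇔ c))))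
  (λ e → Equivalence.from Cond⇔ (C∣b-a e , crossᴺ⇒cross (Equivalence.from (*-cross≡⇔≡/gcd x y a⊥b) e)))
  where
  open ≡-Reasoning
  Cond⇔ : Cond C D u v a b ⇔ (+ C ∣ + b - + a × + a * (+ C * u ^ 2 + D) ≡ + b * (+ C * v ^ 2 + D))
  Cond⇔ = Cond⇔∣×cross C D u v a b
  g : ℕ
  g = ℕG.gcd x y

  cross⇒crossᴺ : + a * (+ C * u ^ 2 + D) ≡ + b * (+ C * v ^ 2 + D) → a ℕ.* x ≡ b ℕ.* y
  cross⇒crossᴺ e = ℤP.+-injective (begin
    + (a ℕ.* x)              ≡⟨ ℤP.pos-* a x ⟩
    + a * + x                ≡⟨ cong (+ a *_) X≡x ⟨
    + a * (+ C * u ^ 2 + D)  ≡⟨ e ⟩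
    + b * (+ C * v ^ 2 + D)  ≡⟨ cong (+ b *_) Y≡y ⟩
    + b * + y                ≡⟨ ℤP.pos-* b y ⟨
    + (b ℕ.* y)              ∎)

  crossᴺ⇒cross : a ℕ.* x ≡ b ℕ.* y → + a * (+ C * u ^ 2 + D) ≡ + b * (+ C * v ^ 2 + D)
  crossᴺ⇒cross e = begin
    + a * (+ C * u ^ 2 + D)  ≡⟨ cong (+ a *_) X≡x ⟩
    + a * + x                ≡⟨ ℤP.pos-* a x ⟨
    + (a ℕ.* x)              ≡⟨ cong +_ e ⟩
    + (b ℕ.* y)              ≡⟨ ℤP.pos-* b y ⟩
    + b * + y                ≡⟨ cong (+ b *_) Y≡y ⟨
    + b * (+ C * v ^ 2 + D)  ∎

  C⊥g : Coprime C g
  C⊥g = ∣[c*u+d]⇒coprime C g (u ^ 2) D C⊥D (subst (λ n → g ℕD.∣ ∣ n ∣) (sym X≡x) (ℕG.gcd[m,n]∣m x y))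

  C∣b-a : a ≡ y ℕ./ g × b ≡ x ℕ./ g → + C ∣ + b - + a
  C∣b-a (refl , refl) = coprime-divisorᶻ (+ b - + a) C⊥g
    (subst (+ C ∣_) (sym g[b-a]≡C[U-V]) (ℤS.∣⇒∣ᵤ (ℤS.∣m⇒∣m*n (u ^ 2 - v ^ 2) (ℤS.∣-refl {+ C}))))
    where
    g[b-a]≡C[U-V] : + g * (+ b - + a) ≡ + C * (u ^ 2 - v ^ 2)
    g[b-a]≡C[U-V] = begin
      + g * (+ b - + a)                      ≡⟨ distrib (+ g) (+ a) (+ b) ⟩
      + b * + g - + a * + g                  ≡⟨ cong₂ _-_ (ℤP.pos-* b g) (ℤP.pos-* a g) ⟨
      + (b ℕ.* g) - + (a ℕ.* g)              ≡⟨ cong₂ (λ m n → + m - + n) (ℕM.m/n*n≡m (ℕG.gcd[m,n]∣m x y))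
                                                                          (ℕM.m/n*n≡m (ℕG.gcd[m,n]∣n x y)) ⟩
      + x - + y                              ≡⟨ cong₂ _-_ X≡x Y≡y ⟨
      (+ C * u ^ 2 + D) - (+ C * v ^ 2 + D)  ≡⟨ cancel (+ C) (u ^ 2) (v ^ 2) D ⟩
      + C * (u ^ 2 - v ^ 2)                  ∎
      where
      distrib : ∀ (g a b : ℤ) → g * (b - a) ≡ b * g - a * g
      distrib = solve-∀
      cancel : ∀ (c U V d : ℤ) → (c * U + d) - (c * V + d) ≡ c * (U - V)
      cancel = solve-∀

0<c*U+d : ∀ c d (U V : ℤ) → - d < + c * (U ⊓ V) → 0ℤ < + c * U + d
0<c*U+d c d U V -d<c[U⊓V] = subst (_< + c * U + d) (ℤP.+-inverseˡ d)
  (ℤP.+-monoˡ-< d (ℤP.<-≤-trans -d<c[U⊓V] (ℤP.*-monoˡ-≤-nonNeg (+ c) (ℤP.i⊓j≤i U V))))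

÷-pos : ∀ m n .{{_ : ℕ.NonZero n}} → (+ m) ÷ (+ n) ≡ + (m ℕ./ n)
÷-pos m (suc n) = div-pos-is-/ℕ (+ m) (suc n)

≡/gcd⇔pair≡÷gcd : ∀ {a b X Y} x y .{{_ : ℕ.NonZero (ℕG.gcd x y)}} → X ≡ + x → Y ≡ + y →
  (a ≡ y ℕ./ ℕG.gcd x y × b ≡ x ℕ./ ℕG.gcd x y) ⇔ ((+ a , + b) ≡ (Y ÷ gcd X Y , X ÷ gcd X Y))
≡/gcd⇔pair≡÷gcd x y refl refl = mk⇔
  (λ { (refl , refl) → sym quotients })
  (λ e → let a≡ , b≡ = ,-injective (trans e quotients) in ℤP.+-injective a≡ , ℤP.+-injective b≡)
  where
  quotients : ((+ y) ÷ gcd (+ x) (+ y) , (+ x) ÷ gcd (+ x) (+ y)) ≡ (+ (y ℕ./ ℕG.gcd x y) , + (x ℕ./ ℕG.gcd x y))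
  quotients = cong₂ _,_ (÷-pos y (ℕG.gcd x y)) (÷-pos x (ℕG.gcd x y))

mainTheorem14 : (C₃ : ℕ) .{{_ : ℕ.NonZero C₃}} (D : ℤ) → D ≢ 0ℤ → gcd (+ C₃) D ≡ 1ℤ →
    (u v : ℤ) → gcd u v ≡ 1ℤ → - D < + C₃ * (u ^ 2 ⊓ v ^ 2) →
    ((a b : ℕ) → ℕG.gcd a b ≡ 1 →
      (Cond C₃ D u v a b ⇔
        ((+ a , + b) ≡ ((+ C₃ * v ^ 2 + D) ÷ kuv C₃ D u v , (+ C₃ * u ^ 2 + D) ÷ kuv C₃ D u v))))
    × (∃[ a ] ∃[ b ] (ℕG.gcd a b ≡ 1 × Cond C₃ D u v a b))
mainTheorem14 C D _ gcd[C,D]≡1 u v _ -D<C*min =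
  (λ a b gcd[a,b]≡1 → ⇔-trans (Cond⇔ (ℕC.gcd≡1⇒coprime gcd[a,b]≡1)) (≡/gcd⇔pair≡÷gcd x y X≡x Y≡y)) ,
  (y ℕ./ g , x ℕ./ g , ℕC.coprime⇒gcd≡1 y/g⊥x/g , Equivalence.from (Cond⇔ y/g⊥x/g) (refl , refl))
  where
  0<X : 0ℤ < + C * u ^ 2 + D
  0<X = 0<c*U+d C D (u ^ 2) (v ^ 2) -D<C*min
  0<Y : 0ℤ < + C * v ^ 2 + D
  0<Y = 0<c*U+d C D (v ^ 2) (u ^ 2) (subst (λ m → - D < + C * m) (ℤP.⊓-comm (u ^ 2) (v ^ 2)) -D<C*min)
  x y g : ℕ
  x = ∣ + C * u ^ 2 + D ∣
  y = ∣ + C * v ^ 2 + D ∣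
  g = ℕG.gcd x y
  instance
    g≢0 : ℕ.NonZero g
    g≢0 = ℕ.≢-nonZero (λ g≡0 → ℕ.≢-nonZero⁻¹ x {{>-nonZero 0<X}} (ℕG.gcd[m,n]≡0⇒m≡0 g≡0))
  X≡x : + C * u ^ 2 + D ≡ + x
  X≡x = sym (ℤP.0≤i⇒+∣i∣≡i (ℤP.<⇒≤ 0<X))
  Y≡y : + C * v ^ 2 + D ≡ + y
  Y≡y = sym (ℤP.0≤i⇒+∣i∣≡i (ℤP.<⇒≤ 0<Y))
  Cond⇔ : ∀ {a b} → Coprime a b → Cond C D u v a b ⇔ (a ≡ y ℕ./ g × b ≡ x ℕ./ g)
  Cond⇔ = Cond⇔≡/gcd C D u v x y (ℕC.gcd≡1⇒coprime (ℤP.+-injective gcd[C,D]≡1)) X≡x Y≡y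
  y/g⊥x/g : Coprime (y ℕ./ g) (x ℕ./ g)
  y/g⊥x/g = ℕC.sym (ℕC.coprime-/gcd x y)
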